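{- Let $A$ be a meet-complemented lattice in which $\Box a$ exists for every $a\in A$. If $Ba$ exists for every $a\in A$, then $Ba\le\Box a$ for every $a\in A$.
   Context: A meet-complemented lattice is a lattice $(A,\wedge,\vee)$, not necessarily distributive, such that for every $a\in A$ the element $\neg a=\max\{b\in A: a\wedge b\le c\text{ for all }c\in A\}$ exists; it is bounded, with least element $0$ and greatest element $1$. For $a\in A$, $\Box a$ denotes $\max\{b\in A: a\vee\neg b=1\}$, and $Ba$ denotes $\max\{b\in A: b\le a \text{ and } b\vee\neg b=1\}$ (the greatest Boolean element below $a$), when these exist. -}

module Defs where

open import Level using (Level; _⊔_)
open import Data.Product using (Σ; _×_)
open import Relation.Binary.Lattice.Bundles using (BoundedLattice)

module _ {c ℓ₁ ℓ₂ : Level} (L : BoundedLattice c ℓ₁ ℓ₂) where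
  open BoundedLattice L

  IsMax : {p : Level} → (Carrier → Set p) → Carrier → Set (c ⊔ ℓ₂ ⊔ p)
  IsMax P m = P m × (∀ b → P b → b ≤ m)

  Disjoint : Carrier → Carrier → Set (c ⊔ ℓ₂)
  Disjoint a b = ∀ x → a ∧ b ≤ x

  record MeetComplement : Set (c ⊔ ℓ₂) where
    field
      ¬_    : Carrier → Carrier
      ¬-max : ∀ a → IsMax (Disjoint a) (¬ a)

  module _ (N : MeetComplement) where
    open MeetComplement N

    IsBox : Carrier → Carrier → Set (c ⊔ ℓ₁ ⊔ ℓ₂)
    IsBox a m = IsMax (λ b → (a ∨ (¬ b)) ≈ ⊤) m

    IsB : Carrier → Carrier → Set (c ⊔ ℓ₁ ⊔ ℓ₂)
    IsB a m = IsMax (λ b → (b ≤ a) × ((b ∨ (¬ b)) ≈ ⊤)) m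

module Submission where

-- Call b "complemented" when b ∨ ¬ b = ⊤.  If a complemented
-- element b lies below a, then ⊤ = b ∨ ¬ b ≤ a ∨ ¬ b, so a ∨ ¬ b = ⊤; that
-- is, b belongs to the set whose maximum is □ a, hence b ≤ □ a.  Thus every
-- complemented element below a is below □ a (this needs only that □ a
-- exists, not that B a does).  Applying this to B a, which is itself
-- complemented and below a, gives B a ≤ □ a.

open import Defs
open import Level using (Level)
open import Data.Product using (Σ; proj₁; _,_)
open import Relation.Binary.Lattice.Bundles using (BoundedLattice)
import Relation.Binary.Lattice.Properties.JoinSemilattice as JoinProperties

module _ {c ℓ₁ ℓ₂ : Level} (L : BoundedLattice c ℓ₁ ℓ₂) (N : MeetComplement L) where
  open BoundedLattice L
  open MeetComplement N
  open JoinProperties joinSemilattice using (∨-monotonic)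

  join-top-mono : ∀ {a b x} → b ≤ a → (b ∨ x) ≈ ⊤ → (a ∨ x) ≈ ⊤
  join-top-mono {a} {b} {x} b≤a b∨x≈⊤ = antisym (maximum (a ∨ x)) ⊤≤a∨x
    where
    ⊤≤a∨x : ⊤ ≤ a ∨ x
    ⊤≤a∨x = trans (reflexive (Eq.sym b∨x≈⊤)) (∨-monotonic b≤a refl)

  complemented-below-box : ∀ {a b m} → IsBox L N a m
    → b ≤ a → (b ∨ (¬ b)) ≈ ⊤ → b ≤ m
  complemented-below-box (_ , box-greatest) b≤a b∨¬b≈⊤ =
    box-greatest _ (join-top-mono b≤a b∨¬b≈⊤)

proposition5 : {c ℓ₁ ℓ₂ : Level} (L : BoundedLattice c ℓ₁ ℓ₂) (N : MeetComplement L)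
    → (box : ∀ a → Σ (BoundedLattice.Carrier L) (IsBox L N a))
    → (bo : ∀ a → Σ (BoundedLattice.Carrier L) (IsB L N a))
    → ∀ a → BoundedLattice._≤_ L (proj₁ (bo a)) (proj₁ (box a))
proposition5 L N box bo a with bo a | box a
... | _ , (Ba≤a , Ba-complemented) , _ | _ , □a-is-box =
  complemented-below-box L N □a-is-box Ba≤a Ba-complemented
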